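{- Let $\mathcal{L}$ be an expansion of the language $\langle +,<,0\rangle$ of ordered abelian groups, and let $G$ be an $\mathcal{L}$-structure whose reduct is a densely ordered abelian group which is definably complete. Fix an $\mathcal{L}$-formula $\psi(t,y)$ (with parameters) such that $\{\psi(t,G)\}_{t\in G}$ is a directed definable family of pseudo-finite sets covering $G$. Then every closed bounded interval $[a,b]$ ($a<b$ in $G$) is definably compact.
   Context: Definable means $\mathcal{L}$-definable with parameters from $G$; for a formula $\varphi(x,y)$ and $a\in G$, $\varphi(a,G)=\{b\in G: G\models\varphi(a,b)\}$, and $\{\varphi(a,G)\}_{a\in G}$ is a definable family. $G$ is definably complete if it has no definable gap, a gap being a nonempty downward closed proper subset of $G$ with no least upper bound in $G$. A definable set $D\subseteq G$ is pseudo-finite if it is discrete, closed and bounded (in the order topology). The family $\{\psi(t,G)\}_{t\in G}$ is directed if $\psi(t_1,G)\subseteq\psi(t_2,G)$ whenever $t_1<t_2$, and covers $G$ if $\bigcup_{t\in G}\psi(t,G)=G$. A definable open cover of $X\subseteq G$ is a definable family $\{\varphi(a,G)\}_{a\in G}$ of open subsets of $G$ whose union contains $X$. A definable set $D\subseteq G$ is definably compact (relative to the fixed family $\psi$) if for every definable open cover $\{\varphi(a,G)\}_{a\in G}$ of $D$ there exists $t_0\in G$ such that, with $P=\psi(t_0,G)$, $D\subseteq\bigcup_{a\in P}\varphi(a,G)$. -}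

module Defs where

open import Data.Nat using (ℕ; suc)
open import Data.Fin using (Fin)
open import Data.Vec using (Vec; []; _∷_; lookup)
open import Data.Maybe using (Maybe; just; nothing)
open import Data.Product using (Σ; _×_; _,_)
open import Data.Sum using (_⊎_)
open import Data.Unit using (⊤)
open import Data.Empty using (⊥)
open import Relation.Nullary using (¬_)
open import Relation.Binary.PropositionalEquality using (_≡_)

record Language : Set₁ where
  field
    Fun   : ℕ → Set
    Rel   : ℕ → Set
    plusS : Fun 2
    zeroS : Fun 0
    lessS : Rel 2

open Language public

record Structure (L : Language) : Set₁ where
  field
    Carrier : Set
    funI    : ∀ {k} → Fun L k → Vec Carrier k → Carrier
    relI    : ∀ {k} → Rel L k → Vec Carrier k → Set

open Structure public

-- Terms in n variables (de Bruijn, var 0 = innermost bound) with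
-- parameters from a set G.
data Term (L : Language) (G : Set) (n : ℕ) : Set where
  var : Fin n → Term L G n
  par : G → Term L G n
  app : ∀ {k} → Fun L k → Vec (Term L G n) k → Term L G n

data Formula (L : Language) (G : Set) (n : ℕ) : Set where
  _≐_  : Term L G n → Term L G n → Formula L G n
  rel  : ∀ {k} → Rel L k → Vec (Term L G n) k → Formula L G n
  ⊥'   : Formula L G n
  _⇒_  : Formula L G n → Formula L G n → Formula L G n
  _∧'_ : Formula L G n → Formula L G n → Formula L G n
  _∨'_ : Formula L G n → Formula L G n → Formula L G n
  ∀'   : Formula L G (suc n) → Formula L G n
  ∃'   : Formula L G (suc n) → Formula L G n

module _ {L : Language} (M : Structure L) where

  private
    G = Carrier M

  mutual
    evalT : ∀ {n} → Term L G n → Vec G n → G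
    evalT (var i) ρ = lookup ρ i
    evalT (par c) ρ = c
    evalT (app f ts) ρ = funI M f (evalTs ts ρ)

    evalTs : ∀ {n k} → Vec (Term L G n) k → Vec G n → Vec G k
    evalTs [] ρ = []
    evalTs (t ∷ ts) ρ = evalT t ρ ∷ evalTs ts ρ

  Sat : ∀ {n} → Formula L G n → Vec G n → Set
  Sat (t ≐ u) ρ = evalT t ρ ≡ evalT u ρ
  Sat (rel R ts) ρ = relI M R (evalTs ts ρ)
  Sat ⊥' ρ = ⊥
  Sat (φ ⇒ χ) ρ = Sat φ ρ → Sat χ ρ
  Sat (φ ∧' χ) ρ = Sat φ ρ × Sat χ ρ
  Sat (φ ∨' χ) ρ = Sat φ ρ ⊎ Sat χ ρ
  Sat (∀' φ) ρ = (x : G) → Sat φ (x ∷ ρ)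
  Sat (∃' φ) ρ = Σ G λ x → Sat φ (x ∷ ρ)

  defSet : Formula L G 1 → G → Set
  defSet φ b = Sat φ (b ∷ [])

  -- φ(a,G) = { b : G ⊨ φ(a,b) } for φ(x,y); x is var 0, y is var 1
  fam : Formula L G 2 → G → G → Set
  fam φ a b = Sat φ (a ∷ b ∷ [])

  _⊕_ : G → G → G
  x ⊕ y = funI M (plusS L) (x ∷ y ∷ [])

  𝟘 : G
  𝟘 = funI M (zeroS L) []

  _≺_ : G → G → Set
  x ≺ y = relI M (lessS L) (x ∷ y ∷ [])

  _≼_ : G → G → Set
  x ≼ y = x ≺ y ⊎ x ≡ y

  record IsDOAG : Set where
    field
      ⊕-assoc    : ∀ x y z → (x ⊕ y) ⊕ z ≡ x ⊕ (y ⊕ z)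
      ⊕-comm     : ∀ x y → x ⊕ y ≡ y ⊕ x
      ⊕-identity : ∀ x → x ⊕ 𝟘 ≡ x
      ⊕-inverse  : ∀ x → Σ G λ y → x ⊕ y ≡ 𝟘
      ≺-irrefl   : ∀ x → ¬ (x ≺ x)
      ≺-trans    : ∀ x y z → x ≺ y → y ≺ z → x ≺ z
      ≺-linear   : ∀ x y → x ≺ y ⊎ (x ≡ y ⊎ y ≺ x)
      ≺-compat   : ∀ x y z → x ≺ y → (x ⊕ z) ≺ (y ⊕ z)
      ≺-dense    : ∀ x y → x ≺ y → Σ G λ z → x ≺ z × z ≺ y

  IsUpperBound : (G → Set) → G → Set
  IsUpperBound D s = ∀ y → D y → y ≼ s

  HasLUB : (G → Set) → Set
  HasLUB D = Σ G λ s → IsUpperBound D s × (∀ u → IsUpperBound D u → s ≼ u)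

  IsGap : (G → Set) → Set
  IsGap D = (Σ G D)
          × (∀ x y → D y → x ≼ y → D x)
          × (Σ G λ x → ¬ D x)
          × ¬ HasLUB D

  DefinablyComplete : Set
  DefinablyComplete = (φ : Formula L G 1) → ¬ IsGap (defSet φ)

  Above : Maybe G → G → Set
  Above nothing x = ⊤
  Above (just l) x = l ≺ x

  Below : Maybe G → G → Set
  Below nothing x = ⊤
  Below (just u) x = x ≺ u

  InBasic : Maybe G → Maybe G → G → Set
  InBasic lo hi x = Above lo x × Below hi x

  IsOpen : (G → Set) → Set
  IsOpen U = ∀ x → U x → Σ (Maybe G) λ lo → Σ (Maybe G) λ hi →
               InBasic lo hi x × (∀ y → InBasic lo hi y → U y)

  IsClosed : (G → Set) → Set
  IsClosed D = IsOpen (λ x → ¬ D x)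

  IsDiscrete : (G → Set) → Set
  IsDiscrete D = ∀ x → D x → Σ (Maybe G) λ lo → Σ (Maybe G) λ hi →
                   InBasic lo hi x × (∀ y → D y → InBasic lo hi y → y ≡ x)

  IsBounded : (G → Set) → Set
  IsBounded D = Σ G λ l → Σ G λ u → ∀ y → D y → l ≼ y × y ≼ u

  PseudoFinite : (G → Set) → Set
  PseudoFinite D = IsDiscrete D × IsClosed D × IsBounded D

  Directed : Formula L G 2 → Set
  Directed ψ = ∀ t₁ t₂ → t₁ ≺ t₂ → ∀ y → fam ψ t₁ y → fam ψ t₂ y

  CoversG : Formula L G 2 → Set
  CoversG ψ = ∀ y → Σ G λ t → fam ψ t y

  DefinablyCompact : Formula L G 2 → (G → Set) → Set
  DefinablyCompact ψ D =
    (φ : Formula L G 2) →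
    (∀ a → IsOpen (fam φ a)) →
    (∀ x → D x → Σ G λ a → fam φ a x) →
    Σ G λ t₀ → ∀ x → D x → Σ G λ a → fam ψ t₀ a × fam φ a x

  ClosedInterval : G → G → G → Set
  ClosedInterval a b x = a ≼ x × x ≼ b

-- Let S be the set of x ≥ a such that [a,x] is covered by the sets φ(c,G) with c ranging
-- over a single ψ(t,G).  Since the family ψ is directed and covers G, any two such
-- index sets fit into a third one, so S is definable, downward closed
-- and contains a.  If b ∉ S, definable completeness gives s = sup S ∈ [a,b]; the open set
-- φ(c,G) containing s meets S on its left and therefore pushes S past s, a contradiction.
module Submission where

open import Defs
open import Level using (0ℓ)
open import Axiom.ExcludedMiddle using (ExcludedMiddle)
open import Data.Fin using (Fin; zero; lift; #_)
open import Data.Vec using (Vec; []; _∷_; lookup; tabulate)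
open import Data.Vec.Properties using (lookup∘tabulate)
open import Data.Maybe using (Maybe; just; nothing)
open import Data.Product using (Σ; _×_; _,_; map₂)
open import Data.Product.Function.NonDependent.Propositional using (_×-⇔_)
open import Data.Product.Function.Dependent.Propositional using (Σ-⇔)
open import Data.Sum using (_⊎_; inj₁; inj₂; [_,_]′)
open import Data.Sum.Function.Propositional using (_⊎-⇔_)
open import Data.Unit using (tt)
open import Data.Empty using (⊥-elim)
open import Function using (_∘_; id)
open import Function.Bundles using (_⇔_; mk⇔; Equivalence)
open import Function.Construct.Identity using (⇔-id; ↠-id)
open import Function.Construct.Symmetry using (⇔-sym)
open import Function.Related.TypeIsomorphisms using (→-cong-⇔)
open import Relation.Nullary using (¬_)
open import Relation.Nullary.Decidable using (decidable-stable)
open import Relation.Binary.PropositionalEquality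
  using (_≡_; refl; sym; cong; cong₂; subst; subst₂)

open Equivalence using (to; from)

Π-⇔ : {A : Set} {B C : A → Set} → (∀ x → B x ⇔ C x) → ((x : A) → B x) ⇔ ((x : A) → C x)
Π-⇔ B⇔C = mk⇔ (λ f x → to (B⇔C x) (f x)) (λ f x → from (B⇔C x) (f x))

module Renaming {L : Language} {G : Set} where

  mutual
    renameT : ∀ {n m} → (Fin n → Fin m) → Term L G n → Term L G m
    renameT r (var i)    = var (r i)
    renameT r (par c)    = par c
    renameT r (app f ts) = app f (renameTs r ts)

    renameTs : ∀ {n m k} → (Fin n → Fin m) → Vec (Term L G n) k → Vec (Term L G m) k
    renameTs r []       = []
    renameTs r (t ∷ ts) = renameT r t ∷ renameTs r ts

  rename : ∀ {n m} → (Fin n → Fin m) → Formula L G n → Formula L G m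
  rename r (t ≐ u)    = renameT r t ≐ renameT r u
  rename r (rel R ts) = rel R (renameTs r ts)
  rename r ⊥'         = ⊥'
  rename r (φ ⇒ χ)    = rename r φ ⇒ rename r χ
  rename r (φ ∧' χ)   = rename r φ ∧' rename r χ
  rename r (φ ∨' χ)   = rename r φ ∨' rename r χ
  rename r (∀' φ)     = ∀' (rename (lift 1 r) φ)
  rename r (∃' φ)     = ∃' (rename (lift 1 r) φ)

module _ {L : Language} (M : Structure L) where

  open Renaming

  private
    G = Carrier M

  mutual
    evalT-rename : ∀ {n m} (r : Fin n → Fin m) (ρ : Vec G m) (t : Term L G n) →
                   evalT M (renameT r t) ρ ≡ evalT M t (tabulate (lookup ρ ∘ r))
    evalT-rename r ρ (var i)    = sym (lookup∘tabulate (lookup ρ ∘ r) i)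
    evalT-rename r ρ (par c)    = refl
    evalT-rename r ρ (app f ts) = cong (funI M f) (evalTs-rename r ρ ts)

    evalTs-rename : ∀ {n m k} (r : Fin n → Fin m) (ρ : Vec G m) (ts : Vec (Term L G n) k) →
                    evalTs M (renameTs r ts) ρ ≡ evalTs M ts (tabulate (lookup ρ ∘ r))
    evalTs-rename r ρ []       = refl
    evalTs-rename r ρ (t ∷ ts) = cong₂ _∷_ (evalT-rename r ρ t) (evalTs-rename r ρ ts)

  Sat-rename : ∀ {n m} (r : Fin n → Fin m) (ρ : Vec G m) (φ : Formula L G n) →
               Sat M (rename r φ) ρ ⇔ Sat M φ (tabulate (lookup ρ ∘ r))
  Sat-rename r ρ (t ≐ u)    = mk⇔ (subst₂ _≡_ t≡ u≡) (subst₂ _≡_ (sym t≡) (sym u≡))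
    where
    t≡ = evalT-rename r ρ t
    u≡ = evalT-rename r ρ u
  Sat-rename r ρ (rel R ts) = mk⇔ (subst (relI M R) ts≡) (subst (relI M R) (sym ts≡))
    where ts≡ = evalTs-rename r ρ ts
  Sat-rename r ρ ⊥'         = ⇔-id _
  Sat-rename r ρ (φ ⇒ χ)    = →-cong-⇔ (Sat-rename r ρ φ) (Sat-rename r ρ χ)
  Sat-rename r ρ (φ ∧' χ)   = Sat-rename r ρ φ ×-⇔ Sat-rename r ρ χ
  Sat-rename r ρ (φ ∨' χ)   = Sat-rename r ρ φ ⊎-⇔ Sat-rename r ρ χ
  Sat-rename r ρ (∀' φ)     = Π-⇔ λ x → Sat-rename (lift 1 r) (x ∷ ρ) φ
  Sat-rename r ρ (∃' φ)     = Σ-⇔ (↠-id _) λ {x} → Sat-rename (lift 1 r) (x ∷ ρ) φ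

  Definable : (G → Set) → Set
  Definable S = Σ (Formula L G 1) λ χ → ∀ x → S x ⇔ defSet M χ x

  DownwardClosed : (G → Set) → Set
  DownwardClosed S = ∀ {x y} → S y → _≼_ M x y → S x

  ExtendsAt : (G → Set) → G → Set
  ExtendsAt S s = Σ (Maybe G) λ lo → Σ (Maybe G) λ hi → InBasic M lo hi s ×
                  (∀ {x w} → S x → Above M lo x → Below M hi w → S w)

  IsLUB : (G → Set) → G → Set
  IsLUB S s = IsUpperBound M S s × (∀ u → IsUpperBound M S u → _≼_ M s u)

  HasLUB-resp-⇔ : {S T : G → Set} → (∀ x → S x ⇔ T x) → HasLUB M T → HasLUB M S
  HasLUB-resp-⇔ S⇔T (s , ub , least) =
    s , (λ y Sy → ub y (to (S⇔T y) Sy)) , (λ u ubS → least u (λ y Ty → ubS y (from (S⇔T y) Ty)))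

module Order {L : Language} {M : Structure L} (isD : IsDOAG M) where

  open IsDOAG isD

  private
    G = Carrier M
    _<_ = _≺_ M
    _≤_ = _≼_ M

  ≼-trans : ∀ {x y z} → x ≤ y → y ≤ z → x ≤ z
  ≼-trans (inj₂ refl) y≤z         = y≤z
  ≼-trans (inj₁ x<y)  (inj₂ refl) = inj₁ x<y
  ≼-trans (inj₁ x<y)  (inj₁ y<z)  = inj₁ (≺-trans _ _ _ x<y y<z)

  ≺-≼-trans : ∀ {x y z} → x < y → y ≤ z → x < z
  ≺-≼-trans x<y (inj₂ refl) = x<y
  ≺-≼-trans x<y (inj₁ y<z)  = ≺-trans _ _ _ x<y y<z

  ≼-≺-trans : ∀ {x y z} → x ≤ y → y < z → x < z
  ≼-≺-trans (inj₂ refl) y<z = y<z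
  ≼-≺-trans (inj₁ x<y)  y<z = ≺-trans _ _ _ x<y y<z

  ≺⇒¬≽ : ∀ {x y} → x < y → ¬ (y ≤ x)
  ≺⇒¬≽ x<y y≤x = ≺-irrefl _ (≺-≼-trans x<y y≤x)

  ≼-or-≻ : ∀ x y → x ≤ y ⊎ y < x
  ≼-or-≻ x y with ≺-linear x y
  ... | inj₁ x<y        = inj₁ (inj₁ x<y)
  ... | inj₂ (inj₁ x≡y) = inj₁ (inj₂ x≡y)
  ... | inj₂ (inj₂ y<x) = inj₂ y<x

  ¬≺⇒≽ : ∀ {x y} → ¬ (y < x) → x ≤ y
  ¬≺⇒≽ {x} {y} y≮x = [ id , ⊥-elim ∘ y≮x ]′ (≼-or-≻ x y)

  ≼-antisym : ∀ {x y} → x ≤ y → y ≤ x → x ≡ y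
  ≼-antisym (inj₂ x≡y) _   = x≡y
  ≼-antisym (inj₁ x<y) y≤x = ⊥-elim (≺⇒¬≽ x<y y≤x)

  ≼-upperBound : ∀ x y → Σ G λ z → x ≤ z × y ≤ z
  ≼-upperBound x y = [ (λ x≤y → y , x≤y , inj₂ refl) , (λ y<x → x , inj₂ refl , inj₁ y<x) ]′
                       (≼-or-≻ x y)

  Above-≺-mono : ∀ lo {x z} → Above M lo x → x < z → Above M lo z
  Above-≺-mono nothing  _   _   = tt
  Above-≺-mono (just l) l<x x<z = ≺-trans _ _ _ l<x x<z

  Below-≼-antimono : ∀ hi {z w} → z ≤ w → Below M hi w → Below M hi z
  Below-≼-antimono nothing  _   _   = tt
  Below-≼-antimono (just h) z≤w w<h = ≼-≺-trans z≤w w<h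

module ContinuousInduction (em : ExcludedMiddle 0ℓ) {L : Language} (M : Structure L)
                           (isD : IsDOAG M) (complete : DefinablyComplete M) where

  open IsDOAG isD using (≺-dense)
  open Order isD

  private
    G = Carrier M
    _<_ = _≺_ M
    _≤_ = _≼_ M

  definable-HasLUB : ∀ {S} → Definable M S → DownwardClosed M S →
                     Σ G S → Σ G (¬_ ∘ S) → HasLUB M S
  definable-HasLUB {S} (χ , S⇔χ) down (x , Sx) (y , ¬Sy) = decidable-stable em λ ¬lub →
    complete χ ( (x , to (S⇔χ x) Sx)
               , (λ u v χv u≤v → to (S⇔χ u) (down (from (S⇔χ v) χv) u≤v))
               , (y , ¬Sy ∘ from (S⇔χ y))
               , ¬lub ∘ HasLUB-resp-⇔ M S⇔χ )

  ≺-lub⇒≺-element : ∀ {S s l} → IsLUB M S s → l < s → Σ G λ y → S y × l < y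
  ≺-lub⇒≺-element (_ , least) l<s = decidable-stable em λ ∄y →
    ≺⇒¬≽ l<s (least _ λ y Sy → ¬≺⇒≽ λ l<y → ∄y (y , Sy , l<y))

  continuous-induction : ∀ {S a b} → Definable M S → DownwardClosed M S → S a →
                         (∀ s → a ≤ s → s ≤ b → ExtendsAt M S s) → S b
  continuous-induction {S} {a} {b} defS down Sa step = decidable-stable em λ ¬Sb →
    let s , isLUB@(ub , least) = definable-HasLUB defS down (a , Sa) (b , ¬Sb)
        s≤b = least b λ y Sy → ¬≺⇒≽ λ b<y → ¬Sb (down Sy (inj₁ b<y))
        lo , hi , (lo<s , s<hi) , push = step s (ub a Sa) s≤b
        x , Sx , lo<x = reachedFromBelow lo lo<s isLUB
    in pastLUB hi s<hi ub ¬Sb (push Sx lo<x)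
    where
    reachedFromBelow : ∀ lo {s} → Above M lo s → IsLUB M S s → Σ G λ x → S x × Above M lo x
    reachedFromBelow nothing  _   _     = a , Sa , tt
    reachedFromBelow (just l) l<s isLUB = ≺-lub⇒≺-element isLUB l<s

    pastLUB : ∀ hi {s} → Below M hi s → IsUpperBound M S s → ¬ S b →
              ¬ (∀ {w} → Below M hi w → S w)
    pastLUB nothing  _   _  ¬Sb below = ¬Sb (below tt)
    pastLUB (just h) s<h ub _   below =
      let w , s<w , w<h = ≺-dense _ h s<h in ≺⇒¬≽ s<w (ub w (below w<h))

module Covering {L : Language} (M : Structure L) (isD : IsDOAG M)
                (ψ : Formula L (Carrier M) 2) (directed : Directed M ψ) (covers : CoversG M ψ)
                (φ : Formula L (Carrier M) 2) (a : Carrier M) where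

  open Order isD
  open Renaming

  private
    G = Carrier M
    _≤_ = _≼_ M

  CoveredBy : G → G → Set
  CoveredBy t z = Σ G λ c → fam M ψ t c × fam M φ c z

  CoveredUpTo : G → Set
  CoveredUpTo x = Σ G λ t → ∀ z → a ≤ z → z ≤ x → CoveredBy t z

  ψ-mono : ∀ {t T} → t ≤ T → ∀ c → fam M ψ t c → fam M ψ T c
  ψ-mono (inj₂ refl) c ψtc = ψtc
  ψ-mono (inj₁ t<T)  c ψtc = directed _ _ t<T c ψtc

  CoveredBy-mono : ∀ {t T z} → t ≤ T → CoveredBy t z → CoveredBy T z
  CoveredBy-mono t≤T (c , ψtc , φcz) = c , ψ-mono t≤T c ψtc , φcz

  CoveredUpTo-downward : DownwardClosed M CoveredUpTo
  CoveredUpTo-downward (t , covered) x≤y = t , λ z a≤z z≤x → covered z a≤z (≼-trans z≤x x≤y)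

  CoveredUpTo-start : Σ G (λ c → fam M φ c a) → CoveredUpTo a
  CoveredUpTo-start (c , φca) = let t , ψtc = covers c in
    t , λ z a≤z z≤a → subst (CoveredBy t) (≼-antisym a≤z z≤a) (c , ψtc , φca)

  CoveredUpTo-extend : ∀ {c} lo hi {x w} → (∀ y → InBasic M lo hi y → fam M φ c y) →
                       CoveredUpTo x → Above M lo x → Below M hi w → CoveredUpTo w
  CoveredUpTo-extend {c} lo hi {x} ⊆φc (t , covered) lo<x w<hi =
    let t′ , ψt′c = covers c
        T , t≤T , t′≤T = ≼-upperBound t t′
    in T , λ z a≤z z≤w →
      [ (λ z≤x → CoveredBy-mono t≤T (covered z a≤z z≤x))
      , (λ x<z → c , ψ-mono t′≤T c ψt′c ,
                 ⊆φc z (Above-≺-mono lo lo<x x<z , Below-≼-antimono hi z≤w w<hi))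
      ]′ (≼-or-≻ z x)

  CoveredUpTo-definable : Definable M CoveredUpTo
  CoveredUpTo-definable = χ , λ x → mk⇔ (map₂ λ f z a≤z z≤x → to (body x z) (f z a≤z z≤x))
                                       (map₂ λ f z a≤z z≤x → from (body x z) (f z a≤z z≤x))
    where
    _≼′_ : ∀ {n} → Term L G n → Term L G n → Formula L G n
    s ≼′ u = rel (lessS L) (s ∷ u ∷ []) ∨' (s ≐ u)

    -- In the innermost scope var 0, 1, 2, 3 are c, z, t, x.
    ψ[t,c] φ[c,z] : Formula L G 4
    ψ[t,c] = rename (lookup (# 2 ∷ # 0 ∷ [])) ψ
    φ[c,z] = rename (lookup (# 0 ∷ # 1 ∷ [])) φ

    χ : Formula L G 1
    χ = ∃' (∀' ((par a ≼′ var zero) ⇒ ((var zero ≼′ var (# 2)) ⇒ ∃' (ψ[t,c] ∧' φ[c,z]))))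

    body : ∀ x z {t} → CoveredBy t z ⇔ Sat M (∃' (ψ[t,c] ∧' φ[c,z])) (z ∷ t ∷ x ∷ [])
    body x z {t} = Σ-⇔ (↠-id _) λ {c} →
      ⇔-sym (Sat-rename M _ (c ∷ z ∷ t ∷ x ∷ []) ψ ×-⇔ Sat-rename M _ (c ∷ z ∷ t ∷ x ∷ []) φ)

theorem3p6 : ExcludedMiddle 0ℓ →
    (L : Language) (M : Structure L) →
    IsDOAG M →
    DefinablyComplete M →
    (ψ : Formula L (Carrier M) 2) →
    Directed M ψ →
    CoversG M ψ →
    (∀ t → PseudoFinite M (fam M ψ t)) →
    (a b : Carrier M) → _≺_ M a b →
    DefinablyCompact M ψ (ClosedInterval M a b)
theorem3p6 em L M isD complete ψ directed covers _ a b a<b φ open-φ covers-[a,b] =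
  let t₀ , covered =
        continuous-induction CoveredUpTo-definable CoveredUpTo-downward
                             (CoveredUpTo-start (covers-[a,b] a (inj₂ refl , inj₁ a<b))) step
  in t₀ , λ x (a≤x , x≤b) → covered x a≤x x≤b
  where
  open ContinuousInduction em M isD complete
  open Covering M isD ψ directed covers φ a

  step : ∀ s → _≼_ M a s → _≼_ M s b → ExtendsAt M CoveredUpTo s
  step s a≤s s≤b =
    let c , φcs = covers-[a,b] s (a≤s , s≤b)
        lo , hi , s∈ , ⊆φc = open-φ c s φcs
    in lo , hi , s∈ , CoveredUpTo-extend lo hi ⊆φc
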